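{- Let $G$ be a connected graph, let $k\ge 1$ be an integer, and let $u\neq v$ be false twins in $G$, i.e., $N(u)=N(v)$. Then: (i) If $G-u$ is strongly conflict-free vertex-connection $k$-colorable, then $G$ is strongly conflict-free vertex-connection $k$-colorable. (ii) If $f$ is a strong conflict-free vertex-connection $k$-coloring of $G$ with $f(u)=f(v)$, then the restriction of $f$ to $V(G)\setminus\{u\}$ is a strong conflict-free vertex-connection $k$-coloring of $G-u$.
   Context: All graphs are finite, simple, undirected. $N(x)$ denotes the (open) neighborhood of a vertex $x$. Given a vertex coloring $f:V(G)\to[k]=\{1,\dots,k\}$, a path is called conflict-free if some color $c\in[k]$ occurs on exactly one vertex of the path. A function $f:V(G)\to[k]$ is a strong conflict-free vertex-connection $k$-coloring of a connected graph $G$ if for any two distinct vertices $x,y$ of $G$ there is a shortest $x,y$-path in $G$ which is conflict-free under $f$. $G$ is strongly conflict-free vertex-connection $k$-colorable if such an $f$ exists. (Such colorings are necessarily proper colorings.) -}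

module Defs where

open import Data.Nat using (ℕ; zero; suc; _≤_)
open import Data.Fin using (Fin; punchIn; _≟_)
open import Data.Bool using (Bool; true; false; T)
open import Data.List using (List; []; _∷_; length; filter)
open import Data.List.Relation.Unary.Unique.Propositional using (Unique)
open import Data.Product using (Σ; _×_; ∃; ∃-syntax)
open import Relation.Binary.PropositionalEquality using (_≡_; _≢_)
open import Function using (_∘_)

record Graph (n : ℕ) : Set where
  field
    adj    : Fin n → Fin n → Bool
    sym    : ∀ i j → adj i j ≡ adj j i
    irrefl : ∀ i → adj i i ≡ false

open Graph public

Edge : ∀ {n} → Graph n → Fin n → Fin n → Set
Edge G i j = T (adj G i j)

data Walk {n : ℕ} (G : Graph n) : Fin n → Fin n → Set where
  []  : ∀ {x} → Walk G x x
  _∷_ : ∀ {x y z} → Edge G x y → Walk G y z → Walk G x z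

vertices : ∀ {n} {G : Graph n} {x y} → Walk G x y → List (Fin n)
vertices {x = x} []      = x ∷ []
vertices {x = x} (e ∷ w) = x ∷ vertices w

len : ∀ {n} {G : Graph n} {x y} → Walk G x y → ℕ
len []      = zero
len (e ∷ w) = suc (len w)

IsPath : ∀ {n} {G : Graph n} {x y} → Walk G x y → Set
IsPath w = Unique (vertices w)

IsShortestPath : ∀ {n} {G : Graph n} {x y} → Walk G x y → Set
IsShortestPath {G = G} {x} {y} w =
  IsPath w × (∀ (w' : Walk G x y) → IsPath w' → len w ≤ len w')

Connected : ∀ {n} → Graph n → Set
Connected G = ∀ x y → Σ (Walk G x y) IsPath

ConflictFree : ∀ {n k} → (Fin n → Fin k) → List (Fin n) → Set
ConflictFree {k = k} f vs = ∃[ c ] length (filter (λ v → f v ≟ c) vs) ≡ 1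

IsSCFColoring : ∀ {n} → Graph n → (k : ℕ) → (Fin n → Fin k) → Set
IsSCFColoring {n} G k f =
  ∀ (x y : Fin n) → x ≢ y →
    Σ (Walk G x y) (λ w → IsShortestPath w × ConflictFree f (vertices w))

SCFColorable : ∀ {n} → Graph n → ℕ → Set
SCFColorable {n} G k = Σ (Fin n → Fin k) (IsSCFColoring G k)

-- G - u : vertex u deleted; vertices of G - u are Fin n, embedded by punchIn u
_─_ : ∀ {n} → Graph (suc n) → Fin (suc n) → Graph n
adj    (G ─ u) i j = adj G (punchIn u i) (punchIn u j)
sym    (G ─ u) i j = sym G (punchIn u i) (punchIn u j)
irrefl (G ─ u) i   = irrefl G (punchIn u i)

restrict : ∀ {n k} → Fin (suc n) → (Fin (suc n) → Fin k) → (Fin n → Fin k)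
restrict u f = f ∘ punchIn u

-- Let σ collapse u onto its twin v, and let ι be the inclusion of G ─ u.  Both are graph
-- homomorphisms and σ ∘ ι is the identity, so distances between vertices other than u are
-- the same in G and in G ─ u, and a shortest path is mapped by either map to a shortest
-- path.  A colouring f of G with f u ≡ f v is invariant under ι ∘ σ, which gives (ii).
-- For (i), colour G by f′ ∘ σ: pairs avoiding u are served through ι, pairs containing u
-- through the embedding of G ─ u that sends v to u (G ─ u ≅ G ─ v), and the pair u, v by
-- a path u z v through a common neighbour z, whose colour differs from that of u and v because
-- a strong conflict-free colouring is proper.

module Submission where

open import Defs hiding (sym)
open import Data.Nat using (ℕ; suc; _≤_; _<_; z≤n; s≤s)
open import Data.Nat.Properties using (≤-refl; ≤-trans; <⇒≤; <⇒≱; m≤n⇒m≤1+n)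
open import Data.Fin using (Fin; punchIn; punchOut; _≟_)
open import Data.Fin.Properties using (punchIn-injective; punchInᵢ≢i; punchIn-punchOut)
open import Data.Bool using (T)
open import Data.List using (List; []; _∷_; length; filter; map)
open import Data.List.Properties using (filter-accept; filter-reject)
open import Data.List.Relation.Unary.Any using (here; there)
open import Data.List.Relation.Unary.All.Properties using (¬Any⇒All¬)
open import Data.List.Relation.Unary.All using ([]; _∷_)
open import Data.List.Relation.Unary.AllPairs using ([]; _∷_)
open import Data.List.Membership.Propositional using (_∈_)
import Data.List.Membership.DecPropositional as DecMembership
open import Data.Product using (Σ; _×_; _,_; ∃; proj₁; proj₂)
open import Data.Sum using (_⊎_; inj₁; inj₂)
open import Relation.Nullary using (¬_; yes; no; contradiction)
open import Relation.Binary.PropositionalEquality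
  using (_≡_; _≢_; refl; sym; trans; cong; subst; subst₂)
open import Function using (_∘_; id)

colourCount : ∀ {n k} → (Fin n → Fin k) → Fin k → List (Fin n) → ℕ
colourCount f c vs = length (filter (λ v → f v ≟ c) vs)

colourCount-map : ∀ {n m k} {f : Fin n → Fin k} {g : Fin m → Fin k} {φ : Fin n → Fin m} →
  (∀ z → g (φ z) ≡ f z) → ∀ c vs → colourCount g c (map φ vs) ≡ colourCount f c vs
colourCount-map         gφ≗f c []       = refl
colourCount-map {f = f} gφ≗f c (a ∷ vs) rewrite gφ≗f a with f a ≟ c
... | yes _ = cong suc (colourCount-map gφ≗f c vs)
... | no _  = colourCount-map gφ≗f c vs

conflictFree-map : ∀ {n m k} {f : Fin n → Fin k} {g : Fin m → Fin k} {φ : Fin n → Fin m} →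
  (∀ z → g (φ z) ≡ f z) → ∀ {vs} → ConflictFree f vs → ConflictFree g (map φ vs)
conflictFree-map gφ≗f {vs} (c , once) = c , trans (colourCount-map gφ≗f c vs) once

conflictFree-pair : ∀ {n k} {f : Fin n → Fin k} {a b} →
  ConflictFree f (a ∷ b ∷ []) → f a ≢ f b
conflictFree-pair {f = f} {a} {b} (c , once) fa≡fb with f a ≟ c | once
... | yes fa≡c | once′ with f b ≟ c | once′
...   | yes _    | ()
...   | no fb≢c  | _ = fb≢c (trans (sym fa≡fb) fa≡c)
conflictFree-pair {f = f} {a} {b} (c , once) fa≡fb | no fa≢c | once′ with f b ≟ c | once′
...   | yes fb≡c | _ = fa≢c (trans fa≡fb fb≡c)
...   | no _     | ()

conflictFree-middle : ∀ {n k} {f : Fin n → Fin k} {a z b} →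
  f a ≢ f z → f b ≢ f z → ConflictFree f (a ∷ z ∷ b ∷ [])
conflictFree-middle {f = f} {z = z} fa≢fz fb≢fz = f z , cong length
  (trans (filter-reject P? fa≢fz) (trans (filter-accept P? refl) (cong (z ∷_) (filter-reject P? fb≢fz))))
  where P? = λ v → f v ≟ f z

CFGeodesic : ∀ {n k} → Graph n → (Fin n → Fin k) → Fin n → Fin n → Set
CFGeodesic G f x y = Σ (Walk G x y) (λ w → IsShortestPath w × ConflictFree f (vertices w))

Twins : ∀ {n} → Graph n → Fin n → Fin n → Set
Twins G a b = ∀ t → adj G a t ≡ adj G b t

Hom : ∀ {n m} → Graph n → Graph m → (Fin n → Fin m) → Set
Hom G H φ = ∀ {x y} → Edge G x y → Edge H (φ x) (φ y)

module _ {n} {G : Graph n} where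

  open DecMembership (_≟_ {n}) using (_∈?_)

  edge-irrefl : ∀ {a b} → Edge G a b → a ≢ b
  edge-irrefl {a} e refl = subst T (irrefl G a) e

  adj-resp-twins : ∀ {a a′ b b′} → Twins G a a′ → Twins G b b′ → adj G a b ≡ adj G a′ b′
  adj-resp-twins {a} {a′} {b} {b′} aa′ bb′ =
    trans (aa′ b) (trans (Graph.sym G a′ b) (trans (bb′ a′) (Graph.sym G b′ a′)))

  twins-nonadjacent : ∀ {a b} → Twins G a b → ¬ Edge G a b
  twins-nonadjacent {b = b} ab e = subst T (trans (ab b) (irrefl G b)) e

  neighbour : Connected G → ∀ {x y} → x ≢ y → ∃ (Edge G x)
  neighbour conn {x} {y} x≢y with conn x y
  ... | []    , _ = contradiction refl x≢y
  ... | e ∷ _ , _ = _ , e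

  suffix : ∀ {x y z} (w : Walk G y z) → x ∈ vertices w →
           Σ (Walk G x z) λ q → len q ≤ len w × (IsPath w → IsPath q)
  suffix []      (here refl) = [] , ≤-refl , id
  suffix (e ∷ w) (here refl) = e ∷ w , ≤-refl , id
  suffix (e ∷ w) (there x∈w) with suffix w x∈w
  ... | q , q≤w , q-path = q , m≤n⇒m≤1+n q≤w , λ { (_ ∷ w-path) → q-path w-path }

  shorten : ∀ {x y} (w : Walk G x y) → IsPath w ⊎ Σ (Walk G x y) (λ p → IsPath p × len p < len w)
  shorten [] = inj₁ ([] ∷ [])
  shorten {x} (e ∷ w) with shorten w
  ... | inj₁ w-path with x ∈? vertices w
  ...   | no x∉w = inj₁ (¬Any⇒All¬ _ x∉w ∷ w-path)
  ...   | yes x∈w with suffix w x∈w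
  ...     | q , q≤w , q-path = inj₂ (q , q-path w-path , s≤s q≤w)
  shorten {x} (e ∷ w) | inj₂ (p , p-path , p<w) with x ∈? vertices p
  ... | no x∉p = inj₂ (e ∷ p , ¬Any⇒All¬ _ x∉p ∷ p-path , s≤s p<w)
  ... | yes x∈p with suffix p x∈p
  ...   | q , q≤p , q-path = inj₂ (q , q-path p-path , ≤-trans (s≤s q≤p) (m≤n⇒m≤1+n p<w))

  isShortestPath-≤-walk : ∀ {x y} {w : Walk G x y} → IsShortestPath w → (w′ : Walk G x y) → len w ≤ len w′
  isShortestPath-≤-walk (_ , w-min) w′ with shorten w′
  ... | inj₁ w′-path             = w-min w′ w′-path
  ... | inj₂ (p , p-path , p<w′) = ≤-trans (w-min p p-path) (<⇒≤ p<w′)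

  retarget : ∀ {x y x′ y′} → x ≡ x′ → y ≡ y′ → Walk G x y → Walk G x′ y′
  retarget refl refl w = w

  len-retarget : ∀ {x y x′ y′} (x≡x′ : x ≡ x′) (y≡y′ : y ≡ y′) (w : Walk G x y) →
                 len (retarget x≡x′ y≡y′ w) ≡ len w
  len-retarget refl refl w = refl

  edge-conflictFree : ∀ {k} {f : Fin n → Fin k} {a b} → a ≢ b → (w : Walk G a b) → len w ≤ 1 →
                      ConflictFree f (vertices w) → f a ≢ f b
  edge-conflictFree         a≢b []          _        _    = contradiction refl a≢b
  edge-conflictFree {f = f} a≢b (_ ∷ [])    _        w-cf = conflictFree-pair {f = f} w-cf
  edge-conflictFree         a≢b (_ ∷ _ ∷ _) (s≤s ()) _

  isSCFColoring-proper : ∀ {k} {f : Fin n → Fin k} → IsSCFColoring G k f →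
                         ∀ {a b} → Edge G a b → f a ≢ f b
  isSCFColoring-proper scf {a} {b} e with scf a b (edge-irrefl e)
  ... | w , (_ , w-min) , w-cf =
    edge-conflictFree (edge-irrefl e) w (w-min (e ∷ []) ((edge-irrefl e ∷ []) ∷ [] ∷ [])) w-cf

  twins-CFGeodesic : ∀ {k} {f : Fin n → Fin k} {a b z} → a ≢ b → Twins G a b →
                     Edge G a z → f a ≢ f z → f a ≡ f b → CFGeodesic G f a b
  twins-CFGeodesic {f = f} {a} {b} {z} a≢b ab az fa≢fz fa≡fb =
    azb , (azb-path , two≤) , conflictFree-middle {f = f} fa≢fz (fa≢fz ∘ trans fa≡fb)
    where
      zb : Edge G z b
      zb = subst T (trans (ab z) (Graph.sym G b z)) az
      azb : Walk G a b
      azb = az ∷ zb ∷ []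
      azb-path : IsPath azb
      azb-path = (edge-irrefl az ∷ a≢b ∷ []) ∷ (edge-irrefl zb ∷ []) ∷ [] ∷ []
      two≤ : (p : Walk G a b) → IsPath p → 2 ≤ len p
      two≤ []            _ = contradiction refl a≢b
      two≤ (e ∷ [])      _ = contradiction e (twins-nonadjacent ab)
      two≤ (_ ∷ _ ∷ _)   _ = s≤s (s≤s z≤n)

module _ {n m} {G : Graph n} {H : Graph m} where

  Hom-resp-twins : ∀ {φ ψ : Fin n → Fin m} → (∀ z → Twins H (φ z) (ψ z)) → Hom G H ψ → Hom G H φ
  Hom-resp-twins {φ} {ψ} φ≈ψ ψ-hom {x} {y} e =
    subst T (sym (adj-resp-twins {G = H} (φ≈ψ x) (φ≈ψ y))) (ψ-hom e)

  mapWalk : (φ : Fin n → Fin m) → Hom G H φ → ∀ {x y} → Walk G x y → Walk H (φ x) (φ y)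
  mapWalk φ φ-hom []      = []
  mapWalk φ φ-hom (e ∷ w) = φ-hom e ∷ mapWalk φ φ-hom w

  vertices-mapWalk : ∀ φ (φ-hom : Hom G H φ) {x y} (w : Walk G x y) →
                     vertices (mapWalk φ φ-hom w) ≡ map φ (vertices w)
  vertices-mapWalk φ φ-hom []      = refl
  vertices-mapWalk φ φ-hom (e ∷ w) = cong (φ _ ∷_) (vertices-mapWalk φ φ-hom w)

  len-mapWalk : ∀ φ (φ-hom : Hom G H φ) {x y} (w : Walk G x y) → len (mapWalk φ φ-hom w) ≡ len w
  len-mapWalk φ φ-hom []      = refl
  len-mapWalk φ φ-hom (e ∷ w) = cong suc (len-mapWalk φ φ-hom w)

-- ψ is only used to pull competing paths of H back to G, so it need only undo φ at the
-- two endpoints.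
module _ {n m} {G : Graph n} {H : Graph m} {φ : Fin n → Fin m} {ψ : Fin m → Fin n}
         (φ-hom : Hom G H φ) (ψ-hom : Hom H G ψ) {x y} (ψφx : ψ (φ x) ≡ x) (ψφy : ψ (φ y) ≡ y) where

  mapWalk-isShortestPath : {w : Walk G x y} → IsShortestPath w → IsShortestPath (mapWalk φ φ-hom w)
  mapWalk-isShortestPath {w} w-sh = φw-path , λ p _ → φw-min p
    where
      φw-min : (p : Walk H (φ x) (φ y)) → len (mapWalk φ φ-hom w) ≤ len p
      φw-min p = subst₂ _≤_ (sym (len-mapWalk φ φ-hom w))
        (trans (len-retarget ψφx ψφy (mapWalk ψ ψ-hom p)) (len-mapWalk ψ ψ-hom p))
        (isShortestPath-≤-walk w-sh (retarget ψφx ψφy (mapWalk ψ ψ-hom p)))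
      φw-path : IsPath (mapWalk φ φ-hom w)
      φw-path with shorten (mapWalk φ φ-hom w)
      ... | inj₁ path         = path
      ... | inj₂ (p , _ , p<) = contradiction (φw-min p) (<⇒≱ p<)

  mapCFGeodesic : ∀ {k} {f : Fin n → Fin k} {g : Fin m → Fin k} → (∀ z → g (φ z) ≡ f z) →
                  CFGeodesic G f x y → CFGeodesic H g (φ x) (φ y)
  mapCFGeodesic {g = g} gφ≗f (w , w-sh , w-cf) =
    mapWalk φ φ-hom w , mapWalk-isShortestPath w-sh ,
    subst (ConflictFree g) (sym (vertices-mapWalk φ φ-hom w)) (conflictFree-map gφ≗f {vertices w} w-cf)

module TwinDeletion {n} (G : Graph (suc n)) (u : Fin (suc n)) (v′ : Fin n)
                    (uv-twins : Twins G u (punchIn u v′)) where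

  ι : Fin n → Fin (suc n)
  ι = punchIn u

  v : Fin (suc n)
  v = ι v′

  u≢v : u ≢ v
  u≢v = punchInᵢ≢i u v′ ∘ sym

  σ : Fin (suc n) → Fin n
  σ z with z ≟ u
  ... | yes _   = v′
  ... | no z≢u = punchOut (z≢u ∘ sym)

  -- The embedding of G ─ u onto G ─ v: the copy of v is sent to its twin u.
  ι′ : Fin n → Fin (suc n)
  ι′ z′ with z′ ≟ v′
  ... | yes _ = u
  ... | no _  = ι z′

  ισ-twins : ∀ z → Twins G (ι (σ z)) z
  ισ-twins z with z ≟ u
  ... | yes refl = sym ∘ uv-twins
  ... | no _     = λ _ → cong (λ t → adj G t _) (punchIn-punchOut _)

  ι′-twins : ∀ z′ → Twins G (ι′ z′) (ι z′)
  ι′-twins z′ with z′ ≟ v′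
  ... | yes refl = uv-twins
  ... | no _     = λ _ → refl

  ισ-resp-colour : ∀ {k} {f : Fin (suc n) → Fin k} → f u ≡ f v → ∀ z → f (ι (σ z)) ≡ f z
  ισ-resp-colour {f = f} fu≡fv z with z ≟ u
  ... | yes refl = sym fu≡fv
  ... | no _     = cong f (punchIn-punchOut _)

  ι-σ : ∀ {z} → z ≢ u → ι (σ z) ≡ z
  ι-σ {z} z≢u with z ≟ u
  ... | yes z≡u = contradiction z≡u z≢u
  ... | no _    = punchIn-punchOut _

  σ-ι : ∀ z′ → σ (ι z′) ≡ z′
  σ-ι z′ = punchIn-injective u _ _ (ι-σ (punchInᵢ≢i u z′))

  σ-u : σ u ≡ v′
  σ-u with u ≟ u
  ... | yes _   = refl
  ... | no u≢u = contradiction refl u≢u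

  σ-ι′ : ∀ z′ → σ (ι′ z′) ≡ z′
  σ-ι′ z′ with z′ ≟ v′
  ... | yes refl = σ-u
  ... | no _     = σ-ι z′

  ι′-v′ : ι′ v′ ≡ u
  ι′-v′ with v′ ≟ v′
  ... | yes _     = refl
  ... | no v′≢v′ = contradiction refl v′≢v′

  ι′-σ : ∀ {z} → z ≢ u → z ≢ v → ι′ (σ z) ≡ z
  ι′-σ {z} z≢u z≢v with σ z ≟ v′
  ... | yes σz≡v′ = contradiction (trans (sym (ι-σ z≢u)) (cong ι σz≡v′)) z≢v
  ... | no _      = ι-σ z≢u

  ι-hom : Hom (G ─ u) G ι
  ι-hom e = e

  σ-hom : Hom G (G ─ u) σ
  σ-hom = Hom-resp-twins {G = G} {H = G} ισ-twins id

  ι′-hom : Hom (G ─ u) G ι′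
  ι′-hom = Hom-resp-twins {G = G ─ u} {H = G} ι′-twins ι-hom

  restrict-isSCFColoring : ∀ {k} (f : Fin (suc n) → Fin k) → IsSCFColoring G k f → f u ≡ f v →
                           IsSCFColoring (G ─ u) k (restrict u f)
  restrict-isSCFColoring f scf fu≡fv x′ y′ x′≢y′ =
    subst₂ (CFGeodesic (G ─ u) (restrict u f)) (σ-ι x′) (σ-ι y′)
      (mapCFGeodesic σ-hom ι-hom (cong ι (σ-ι x′)) (cong ι (σ-ι y′)) (ισ-resp-colour fu≡fv)
        (scf (ι x′) (ι y′) (x′≢y′ ∘ punchIn-injective u x′ y′)))

  module Extension {k} {f′ : Fin n → Fin k} (conn : Connected G) (scf : IsSCFColoring (G ─ u) k f′) where

    f : Fin (suc n) → Fin k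
    f = f′ ∘ σ

    embedGeodesic : ∀ {ε} → Hom (G ─ u) G ε → (∀ z′ → σ (ε z′) ≡ z′) →
          ∀ {a b} → a ≢ b → CFGeodesic G f (ε a) (ε b)
    embedGeodesic ε-hom σε a≢b = mapCFGeodesic ε-hom σ-hom (σε _) (σε _) (cong f′ ∘ σε) (scf _ _ a≢b)

    fu≡fv : f u ≡ f v
    fu≡fv = cong f′ (trans σ-u (sym (σ-ι v′)))

    z : Fin (suc n)
    z = proj₁ (neighbour conn u≢v)

    uz : Edge G u z
    uz = proj₂ (neighbour conn u≢v)

    fu≢fz : f u ≢ f z
    fu≢fz = isSCFColoring-proper scf (σ-hom uz)

    from-u : ∀ {y} → y ≢ u → CFGeodesic G f u y
    from-u {y} y≢u with y ≟ v
    ... | yes refl = twins-CFGeodesic u≢v uv-twins uz fu≢fz fu≡fv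
    ... | no y≢v   = subst₂ (CFGeodesic G f) ι′-v′ (ι′-σ y≢u y≢v)
                       (embedGeodesic ι′-hom σ-ι′ (λ v′≡σy → y≢v (trans (sym (ι-σ y≢u)) (cong ι (sym v′≡σy)))))

    to-u : ∀ {x} → x ≢ u → CFGeodesic G f x u
    to-u {x} x≢u with x ≟ v
    ... | yes refl = twins-CFGeodesic (u≢v ∘ sym) (sym ∘ uv-twins)
                       (subst T (uv-twins z) uz) (fu≢fz ∘ trans fu≡fv) (sym fu≡fv)
    ... | no x≢v   = subst₂ (CFGeodesic G f) (ι′-σ x≢u x≢v) ι′-v′
                       (embedGeodesic ι′-hom σ-ι′ (λ σx≡v′ → x≢v (trans (sym (ι-σ x≢u)) (cong ι σx≡v′))))

    isSCFColoring : IsSCFColoring G k f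
    isSCFColoring x y x≢y with x ≟ u | y ≟ u
    ... | yes refl | yes refl = contradiction refl x≢y
    ... | yes refl | no y≢u   = from-u y≢u
    ... | no x≢u   | yes refl = to-u x≢u
    ... | no x≢u   | no y≢u   = subst₂ (CFGeodesic G f) (ι-σ x≢u) (ι-σ y≢u)
                                  (embedGeodesic ι-hom σ-ι (x≢y ∘ subst₂ _≡_ (ι-σ x≢u) (ι-σ y≢u) ∘ cong ι))

mainTheorem1 : ∀ {n : ℕ} (G : Graph (suc n)) (k : ℕ) → 1 ≤ k → Connected G →
    (u v : Fin (suc n)) → u ≢ v → (∀ w → adj G u w ≡ adj G v w) →
    (SCFColorable (G ─ u) k → SCFColorable G k)
    × (∀ (f : Fin (suc n) → Fin k) → IsSCFColoring G k f → f u ≡ f v →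
    IsSCFColoring (G ─ u) k (restrict u f))
mainTheorem1 G k _ conn u v u≢v uv-twins with punchOut u≢v | punchIn-punchOut u≢v
... | v′ | refl = (λ (f′ , scf) → f′ ∘ σ , Extension.isSCFColoring conn scf) , restrict-isSCFColoring
  where open TwinDeletion G u v′ uv-twins
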